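{- Let $\mathbf{T}(X_1)$ be the free groupoid on one generator, i.e., the set of all groupoid terms over the single variable $x_1$ with the binary operation $(s,t)\mapsto (st)$. Then for every $n\in\mathbb{N}_+$, $s^{\mathrm{ac}}_n(\mathbf{T}(X_1)) = n!\,C_{n-1}$, where $C_m=\frac{1}{m+1}\binom{2m}{m}$ is the $m$-th Catalan number.
   Context: A groupoid is a nonempty set $G$ with a binary operation $*$. For $X_n=\{x_1,\dots,x_n\}$, a groupoid term over $X_n$ is built recursively: each variable is a term, and if $s,t$ are terms then $(st)$ is a term. A full linear term over $X_n$ is a term in which each of $x_1,\dots,x_n$ occurs exactly once (equivalently, a valid parenthesization of a word $x_{\sigma(1)}\cdots x_{\sigma(n)}$ for some permutation $\sigma$ of $\{1,\dots,n\}$). Each term $t$ over $X_n$ induces an $n$-ary term operation $t^{\mathbf{G}}\colon G^n\to G$ by interpreting the juxtaposition as $*$. The associative-commutative spectrum (ac-spectrum) of $\mathbf{G}$ is the sequence $s^{\mathrm{ac}}_n(\mathbf{G})$ = the number of distinct term operations on $\mathbf{G}$ induced by full linear terms over $X_n$. -}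

module Defs where

open import Data.Nat using (ℕ; zero; suc; _+_; _*_; _/_)
open import Data.Nat.Combinatorics using (_C_)
open import Data.Fin using (Fin; _≟_)
open import Data.List using (List; length)
open import Data.List.Relation.Unary.All using (All)
open import Data.List.Relation.Unary.Any using (Any)
open import Data.List.Relation.Unary.AllPairs using (AllPairs)
open import Data.Product using (Σ; _×_)
open import Relation.Binary.PropositionalEquality using (_≡_)
open import Relation.Nullary using (¬_; yes; no)

data Term (n : ℕ) : Set where
  var  : Fin n → Term n
  _·_  : Term n → Term n → Term n

occ : {n : ℕ} → Fin n → Term n → ℕ
occ i (var j) with i ≟ j
... | yes _ = 1
... | no  _ = 0
occ i (s · t) = occ i s + occ i t

FullLinear : {n : ℕ} → Term n → Set
FullLinear {n} t = (i : Fin n) → occ i t ≡ 1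

eval : {G : Set} → (G → G → G) → {n : ℕ} → Term n → (Fin n → G) → G
eval op (var i) a = a i
eval op (s · t) a = op (eval op s a) (eval op t a)

SameOp : {G : Set} → (G → G → G) → {n : ℕ} → Term n → Term n → Set
SameOp op s t = (a : _) → eval op s a ≡ eval op t a

-- s^ac_n(G, op) = k : there is a list of k full linear terms whose induced
-- operations are pairwise distinct and represent every operation induced by
-- a full linear term.
AcSpectrumIs : {G : Set} → (G → G → G) → ℕ → ℕ → Set
AcSpectrumIs op n k =
  Σ (List (Term n)) λ ts →
      All FullLinear ts
    × length ts ≡ k
    × AllPairs (λ s t → ¬ SameOp op s t) ts
    × ((t : Term n) → FullLinear t → Any (SameOp op t) ts)

data T₁ : Set where
  x₁  : T₁
  _∙_ : T₁ → T₁ → T₁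

catalan : ℕ → ℕ
catalan m = ((m + m) C m) / suc m

{-# OPTIONS --safe #-}
module Submission where

-- In the free groupoid, evaluation at pairwise distinct values other than x₁ is injective
-- on terms, so distinct terms induce distinct term operations and the ac-spectrum simply
-- counts full linear terms. Attaching a new variable as the left or right sibling of one of
-- the 2k − 1 nodes of a full linear term on k variables produces every full linear term on
-- k + 1 variables exactly once; hence there are ∏_{k=1}^{m} 2(2k − 1) = (2m)!/m! = (m+1)! C_m
-- full linear terms on m + 1 variables.

open import Defs
open import Data.Nat using (ℕ; zero; suc; _+_; _*_; _∸_; _!; _≤_; _<_; z<s)
open import Data.Nat.Combinatorics using (_C_; nCk≡n!/k![n-k]!; k![n∸k]!∣n!; [n-k]*[n-k-1]!≡[n-k]!)
open import Data.Nat.Divisibility using (_∣_; ∣m+n∣m⇒∣n; n∣m*n)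
open import Data.Nat.DivMod using (m/n*n≡m)
open import Data.Nat.Properties
  using (+-identityʳ; +-comm; +-suc; *-suc; *-cancelʳ-≡; m+n≡0⇒m≡0; m+n≡0⇒n≡0; 0≢1+n;
         <⇒≤; m<m+n; m≤m+n; m+n∸m≡n; _!≢0; _!*_!≢0)
open import Data.Nat.Tactic.RingSolver using (solve-∀)
open import Data.Fin using (Fin; zero; suc; toℕ; _≟_)
open import Data.Fin.Properties using (toℕ-injective)
open import Data.List using (List; []; _∷_; [_]; _++_; map; concatMap; length)
open import Data.List.Properties using (length-++; length-map)
open import Data.List.Membership.Propositional using (_∈_; _∉_)
open import Data.List.Membership.Propositional.Properties
  using (∈-map⁺; ∈-map⁻; ∈-++⁺ˡ; ∈-++⁺ʳ; ∈-++⁻; ∈-concatMap⁺)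
open import Data.List.Relation.Unary.Any as Any using (here; there)
open import Data.List.Relation.Unary.All as All using (All; []; _∷_)
import Data.List.Relation.Unary.All.Properties as All
open import Data.List.Relation.Unary.AllPairs as AllPairs using ([]; _∷_)
import Data.List.Relation.Unary.AllPairs.Properties as AllPairs
open import Data.List.Relation.Unary.Unique.Propositional using (Unique)
import Data.List.Relation.Unary.Unique.Propositional.Properties as Unique
open import Data.List.Relation.Binary.Disjoint.Propositional using (Disjoint)
open import Data.Maybe using (Maybe; just; nothing)
open import Data.Maybe.Properties using (just-injective)
open import Data.Product using (_×_; _,_; ∃)
open import Data.Sum using (_⊎_; inj₁; inj₂)
open import Data.Empty using (⊥; ⊥-elim)
open import Function using (_∘_)
open import Relation.Nullary using (yes; no; contradiction)
open import Relation.Binary.PropositionalEquality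
  using (_≡_; _≢_; refl; sym; trans; cong; cong₂; subst; module ≡-Reasoning)

private
  variable
    n : ℕ
    A B : Set

-- The free groupoid separates terms

∙-injectiveˡ : ∀ {a b c d} → a ∙ b ≡ c ∙ d → a ≡ c
∙-injectiveˡ refl = refl

∙-injectiveʳ : ∀ {a b c d} → a ∙ b ≡ c ∙ d → b ≡ d
∙-injectiveʳ refl = refl

rightComb : ℕ → T₁
rightComb zero    = x₁
rightComb (suc k) = x₁ ∙ rightComb k

rightComb-injective : ∀ k l → rightComb k ≡ rightComb l → k ≡ l
rightComb-injective zero    zero    _  = refl
rightComb-injective (suc k) (suc l) eq = cong suc (rightComb-injective k l (∙-injectiveʳ eq))

separating : Fin n → T₁
separating i = x₁ ∙ rightComb (toℕ i)

eval-separating≢x₁ : (t : Term n) → eval _∙_ t separating ≢ x₁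
eval-separating≢x₁ (var i) ()
eval-separating≢x₁ (s · t) ()

eval-separating-injective : (s t : Term n) →
  eval _∙_ s separating ≡ eval _∙_ t separating → s ≡ t
eval-separating-injective (var i) (var j) eq =
  cong var (toℕ-injective (rightComb-injective _ _ (∙-injectiveʳ eq)))
eval-separating-injective (var i) (t · _) eq =
  ⊥-elim (eval-separating≢x₁ t (sym (∙-injectiveˡ eq)))
eval-separating-injective (s · _) (var j) eq =
  ⊥-elim (eval-separating≢x₁ s (∙-injectiveˡ eq))
eval-separating-injective (s₁ · s₂) (t₁ · t₂) eq =
  cong₂ _·_ (eval-separating-injective s₁ t₁ (∙-injectiveˡ eq))
            (eval-separating-injective s₂ t₂ (∙-injectiveʳ eq))

SameOp⇒≡ : {s t : Term n} → SameOp _∙_ s t → s ≡ t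
SameOp⇒≡ {s = s} {t} same = eval-separating-injective s t (same separating)

-- Inserting a new variable

·-injectiveˡ : {a b c d : Term n} → a · b ≡ c · d → a ≡ c
·-injectiveˡ refl = refl

·-injectiveʳ : {a b c d : Term n} → a · b ≡ c · d → b ≡ d
·-injectiveʳ refl = refl

x₀ : Term (suc n)
x₀ = var zero

shift : Term n → Term (suc n)
shift (var i) = var (suc i)
shift (s · t) = shift s · shift t

shift≢x₀ : (t : Term n) → shift t ≢ x₀
shift≢x₀ (var i) ()
shift≢x₀ (s · t) ()

occ-zero-shift : (t : Term n) → occ zero (shift t) ≡ 0
occ-zero-shift (var i) = refl
occ-zero-shift (s · t) = cong₂ _+_ (occ-zero-shift s) (occ-zero-shift t)

occ-suc-shift : (i : Fin n) (t : Term n) → occ (suc i) (shift t) ≡ occ i t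
occ-suc-shift i (var j) with i ≟ j
... | yes _ = refl
... | no  _ = refl
occ-suc-shift i (s · t) = cong₂ _+_ (occ-suc-shift i s) (occ-suc-shift i t)

unshift : (u : Term (suc n)) → occ zero u ≡ 0 → ∃ λ t → shift t ≡ u
unshift (var (suc i)) _ = var i , refl
unshift (a · b) occ≡0
  with unshift a (m+n≡0⇒m≡0 (occ zero a) occ≡0) | unshift b (m+n≡0⇒n≡0 (occ zero a) occ≡0)
... | s , refl | t , refl = s · t , refl

data Insertion {n : ℕ} : Term n → Term (suc n) → Set where
  atRootˡ : ∀ {t} → Insertion t (x₀ · shift t)
  atRootʳ : ∀ {t} → Insertion t (shift t · x₀)
  inLeft  : ∀ {s t a} → Insertion s a → Insertion (s · t) (a · shift t)
  inRight : ∀ {s t b} → Insertion t b → Insertion (s · t) (shift s · b)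

mutual
  insertions : Term n → List (Term (suc n))
  insertions t = x₀ · shift t ∷ shift t · x₀ ∷ insertionsBelow t

  insertionsBelow : Term n → List (Term (suc n))
  insertionsBelow (var _) = []
  insertionsBelow (s · t) = map (_· shift t) (insertions s) ++ map (shift s ·_) (insertions t)

∈-insertions⁺ : {t : Term n} {u : Term (suc n)} → Insertion t u → u ∈ insertions t
∈-insertions⁺ atRootˡ      = here refl
∈-insertions⁺ atRootʳ      = there (here refl)
∈-insertions⁺ (inLeft s↝a) = there (there (∈-++⁺ˡ (∈-map⁺ _ (∈-insertions⁺ s↝a))))
∈-insertions⁺ {t = s · _} (inRight t↝b) =
  there (there (∈-++⁺ʳ (map _ (insertions s)) (∈-map⁺ _ (∈-insertions⁺ t↝b))))

∈-insertions⁻ : (t : Term n) {u : Term (suc n)} → u ∈ insertions t → Insertion t u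
∈-insertions⁻ t (here refl)         = atRootˡ
∈-insertions⁻ t (there (here refl)) = atRootʳ
∈-insertions⁻ (s · t) (there (there u∈)) with ∈-++⁻ (map (_· shift t) (insertions s)) u∈
... | inj₁ u∈ˡ with ∈-map⁻ (_· shift t) u∈ˡ
...   | a , a∈ , refl = inLeft (∈-insertions⁻ s a∈)
∈-insertions⁻ (s · t) (there (there u∈)) | inj₂ u∈ʳ with ∈-map⁻ (shift s ·_) u∈ʳ
...   | b , b∈ , refl = inRight (∈-insertions⁻ t b∈)

All-insertions : {P : Term (suc n) → Set} (t : Term n) →
  (∀ {u} → Insertion t u → P u) → All P (insertions t)
All-insertions t P-ins = All.tabulate (λ u∈ → P-ins (∈-insertions⁻ t u∈))

m+n≡1-cases : ∀ m n → m + n ≡ 1 → (m ≡ 1 × n ≡ 0) ⊎ (m ≡ 0 × n ≡ 1)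
m+n≡1-cases zero       n    eq = inj₂ (refl , eq)
m+n≡1-cases (suc zero) zero _  = inj₁ (refl , refl)

insertion-complete : (u : Term (suc n)) → occ zero u ≡ 1 → u ≡ x₀ ⊎ ∃ λ t → Insertion t u
insertion-complete (var zero) _ = inj₁ refl
insertion-complete (a · b) occ≡1 with m+n≡1-cases (occ zero a) (occ zero b) occ≡1
... | inj₁ (a≡1 , b≡0) with unshift b b≡0 | insertion-complete a a≡1
...   | t , refl | inj₁ refl       = inj₂ (t , atRootˡ)
...   | t , refl | inj₂ (s , s↝a) = inj₂ (s · t , inLeft s↝a)
insertion-complete (a · b) occ≡1 | inj₂ (a≡0 , b≡1) with unshift a a≡0 | insertion-complete b b≡1
...   | s , refl | inj₁ refl       = inj₂ (s , atRootʳ)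
...   | s , refl | inj₂ (t , t↝b) = inj₂ (s · t , inRight t↝b)

Insertion⇒occ-zero : {t : Term n} {u : Term (suc n)} → Insertion t u → occ zero u ≡ 1
Insertion⇒occ-zero {t = t} atRootˡ = cong suc (occ-zero-shift t)
Insertion⇒occ-zero {t = t} atRootʳ = cong (_+ 1) (occ-zero-shift t)
Insertion⇒occ-zero {t = _ · t} (inLeft s↝a) = cong₂ _+_ (Insertion⇒occ-zero s↝a) (occ-zero-shift t)
Insertion⇒occ-zero {t = s · _} (inRight t↝b) = cong₂ _+_ (occ-zero-shift s) (Insertion⇒occ-zero t↝b)

Insertion⇒occ-suc : {t : Term n} {u : Term (suc n)} (i : Fin n) →
  Insertion t u → occ (suc i) u ≡ occ i t
Insertion⇒occ-suc {t = t} i atRootˡ = occ-suc-shift i t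
Insertion⇒occ-suc {t = t} i atRootʳ = trans (+-identityʳ _) (occ-suc-shift i t)
Insertion⇒occ-suc {t = _ · t} i (inLeft s↝a) =
  cong₂ _+_ (Insertion⇒occ-suc i s↝a) (occ-suc-shift i t)
Insertion⇒occ-suc {t = s · _} i (inRight t↝b) =
  cong₂ _+_ (occ-suc-shift i s) (Insertion⇒occ-suc i t↝b)

Insertion-preserves-FullLinear : {t : Term n} {u : Term (suc n)} →
  Insertion t u → FullLinear t → FullLinear u
Insertion-preserves-FullLinear t↝u lin zero    = Insertion⇒occ-zero t↝u
Insertion-preserves-FullLinear t↝u lin (suc i) = trans (Insertion⇒occ-suc i t↝u) (lin i)

Insertion-reflects-FullLinear : {t : Term n} {u : Term (suc n)} →
  Insertion t u → FullLinear u → FullLinear t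
Insertion-reflects-FullLinear t↝u lin i = trans (sym (Insertion⇒occ-suc i t↝u)) (lin (suc i))

size : Term n → ℕ
size (var _) = 1
size (s · t) = suc (size s + size t)

size-shift : (t : Term n) → size (shift t) ≡ size t
size-shift (var i) = refl
size-shift (s · t) = cong suc (cong₂ _+_ (size-shift s) (size-shift t))

Insertion⇒size : {t : Term n} {u : Term (suc n)} → Insertion t u → size u ≡ 2 + size t
Insertion⇒size {t = t} atRootˡ = cong (2 +_) (size-shift t)
Insertion⇒size {t = t} atRootʳ = cong suc (trans (+-comm (size (shift t)) 1) (cong suc (size-shift t)))
Insertion⇒size {t = _ · t} (inLeft s↝a) = cong suc (cong₂ _+_ (Insertion⇒size s↝a) (size-shift t))
Insertion⇒size {t = s · t} (inRight t↝b) = begin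
  suc (size (shift s) + size _)     ≡⟨ cong suc (cong₂ _+_ (size-shift s) (Insertion⇒size t↝b)) ⟩
  suc (size s + (2 + size t))       ≡⟨ cong suc (+-suc (size s) (suc (size t))) ⟩
  suc (suc (size s + suc (size t))) ≡⟨ cong (2 +_) (+-suc (size s) (size t)) ⟩
  2 + size (s · t)                  ∎
  where open ≡-Reasoning

length-insertions : (t : Term n) → length (insertions t) ≡ 2 * size t
length-insertions (var _) = refl
length-insertions (s · t) = begin
  2 + length (map (_· shift t) (insertions s) ++ map (shift s ·_) (insertions t))
    ≡⟨ cong (2 +_) (length-++ (map (_· shift t) (insertions s))) ⟩
  2 + (length (map (_· shift t) (insertions s)) + length (map (shift s ·_) (insertions t)))
    ≡⟨ cong (2 +_) (cong₂ _+_ (trans (length-map _ (insertions s)) (length-insertions s))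
                              (trans (length-map _ (insertions t)) (length-insertions t))) ⟩
  2 + (2 * size s + 2 * size t)
    ≡⟨ double-suc (size s) (size t) ⟩
  2 * size (s · t) ∎
  where
  open ≡-Reasoning
  double-suc : ∀ a b → 2 + (2 * a + 2 * b) ≡ 2 * suc (a + b)
  double-suc = solve-∀

delete : Term (suc n) → Maybe (Term n)
delete (var zero)    = nothing
delete (var (suc i)) = just (var i)
delete (a · b) = merge (delete a) (delete b)
  where
  merge : Maybe (Term _) → Maybe (Term _) → Maybe (Term _)
  merge nothing  t        = t
  merge (just s) nothing  = just s
  merge (just s) (just t) = just (s · t)

delete-shift : (t : Term n) → delete (shift t) ≡ just t
delete-shift (var i) = refl
delete-shift (s · t) rewrite delete-shift s | delete-shift t = refl

Insertion⇒delete : {t : Term n} {u : Term (suc n)} → Insertion t u → delete u ≡ just t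
Insertion⇒delete {t = t} atRootˡ rewrite delete-shift t = refl
Insertion⇒delete {t = t} atRootʳ rewrite delete-shift t = refl
Insertion⇒delete {t = _ · t} (inLeft s↝a) rewrite Insertion⇒delete s↝a | delete-shift t = refl
Insertion⇒delete {t = s · _} (inRight t↝b) rewrite delete-shift s | Insertion⇒delete t↝b = refl

insertions-disjoint : {s t : Term n} → s ≢ t → Disjoint (insertions s) (insertions t)
insertions-disjoint {s = s} {t} s≢t {u} (u∈s , u∈t) = s≢t (just-injective (begin
  just s   ≡⟨ Insertion⇒delete (∈-insertions⁻ s u∈s) ⟨
  delete u ≡⟨ Insertion⇒delete (∈-insertions⁻ t u∈t) ⟩
  just t   ∎))
  where open ≡-Reasoning

x₀∉insertions : (t : Term n) → x₀ ∉ insertions t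
x₀∉insertions t x₀∈ with () ← ∈-insertions⁻ t x₀∈

shift∉insertions : (s t : Term n) → shift s ∉ insertions t
shift∉insertions s t shift∈ =
  0≢1+n (trans (sym (occ-zero-shift s)) (Insertion⇒occ-zero (∈-insertions⁻ t shift∈)))

x₀·shift∉insertionsBelow : (t : Term n) → x₀ · shift t ∉ insertionsBelow t
x₀·shift∉insertionsBelow (s · t) u∈ with ∈-++⁻ (map (_· shift t) (insertions s)) u∈
... | inj₁ u∈ˡ with ∈-map⁻ (_· shift t) u∈ˡ
...   | a , a∈ , eq = x₀∉insertions s (subst (_∈ insertions s) (sym (·-injectiveˡ eq)) a∈)
x₀·shift∉insertionsBelow (s · t) u∈ | inj₂ u∈ʳ with ∈-map⁻ (shift s ·_) u∈ʳ
...   | _ , _ , eq = shift≢x₀ s (sym (·-injectiveˡ eq))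

shift·x₀∉insertionsBelow : (t : Term n) → shift t · x₀ ∉ insertionsBelow t
shift·x₀∉insertionsBelow (s · t) u∈ with ∈-++⁻ (map (_· shift t) (insertions s)) u∈
... | inj₁ u∈ˡ with ∈-map⁻ (_· shift t) u∈ˡ
...   | _ , _ , eq = shift≢x₀ t (sym (·-injectiveʳ eq))
shift·x₀∉insertionsBelow (s · t) u∈ | inj₂ u∈ʳ with ∈-map⁻ (shift s ·_) u∈ʳ
...   | b , b∈ , eq = x₀∉insertions t (subst (_∈ insertions t) (sym (·-injectiveʳ eq)) b∈)

mutual
  insertions-unique : (t : Term n) → Unique (insertions t)
  insertions-unique t =
    (atRoots-distinct ∷ All.¬Any⇒All¬ _ (x₀·shift∉insertionsBelow t)) ∷
    All.¬Any⇒All¬ _ (shift·x₀∉insertionsBelow t) ∷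
    insertionsBelow-unique t
    where
    atRoots-distinct : x₀ · shift t ≢ shift t · x₀
    atRoots-distinct eq = shift≢x₀ t (sym (·-injectiveˡ eq))

  insertionsBelow-unique : (t : Term n) → Unique (insertionsBelow t)
  insertionsBelow-unique (var _) = []
  insertionsBelow-unique (s · t) =
    Unique.++⁺ (Unique.map⁺ ·-injectiveˡ (insertions-unique s))
               (Unique.map⁺ ·-injectiveʳ (insertions-unique t))
               disjoint
    where
    disjoint : Disjoint (map (_· shift t) (insertions s)) (map (shift s ·_) (insertions t))
    disjoint (u∈ˡ , u∈ʳ) with ∈-map⁻ (_· shift t) u∈ˡ | ∈-map⁻ (shift s ·_) u∈ʳ
    ... | a , a∈ , refl | _ , _ , eq =
      shift∉insertions s s (subst (_∈ insertions s) (·-injectiveˡ eq) a∈)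

-- Enumerating the full linear terms

All-concatMap : {P : B → Set} {f : A → List B} {xs : List A} →
  All (All P ∘ f) xs → All P (concatMap f xs)
All-concatMap = All.concat⁺ ∘ All.map⁺

length-concatMap-const : (f : A → List B) {c : ℕ} {xs : List A} →
  All (λ x → length (f x) ≡ c) xs → length (concatMap f xs) ≡ length xs * c
length-concatMap-const f []                         = refl
length-concatMap-const f {xs = x ∷ _} (len≡ ∷ lens) =
  trans (length-++ (f x)) (cong₂ _+_ len≡ (length-concatMap-const f lens))

Term0-empty : Term 0 → ⊥
Term0-empty (s · _) = Term0-empty s

fullLinearTerms : (m : ℕ) → List (Term (suc m))
fullLinearTerms zero    = [ x₀ ]
fullLinearTerms (suc m) = concatMap insertions (fullLinearTerms m)

fullLinearTerms-FullLinear : (m : ℕ) → All FullLinear (fullLinearTerms m)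
fullLinearTerms-FullLinear zero    = (λ { zero → refl }) ∷ []
fullLinearTerms-FullLinear (suc m) = All-concatMap (All.map
  (λ {t} lin → All-insertions t (λ t↝u → Insertion-preserves-FullLinear t↝u lin))
  (fullLinearTerms-FullLinear m))

fullLinearTerms-size : (m : ℕ) → All (λ u → size u ≡ suc (m + m)) (fullLinearTerms m)
fullLinearTerms-size zero    = refl ∷ []
fullLinearTerms-size (suc m) = All-concatMap (All.map
  (λ {t} size≡ → All-insertions t (λ t↝u →
     trans (Insertion⇒size t↝u) (cong (2 +_) (trans size≡ (sym (+-suc m m))))))
  (fullLinearTerms-size m))

fullLinearTerms-unique : (m : ℕ) → Unique (fullLinearTerms m)
fullLinearTerms-unique zero    = [] ∷ []
fullLinearTerms-unique (suc m) =
  Unique.concat⁺ (All.map⁺ (All.tabulate (λ {t} _ → insertions-unique t)))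
                 (AllPairs.map⁺ (AllPairs.map insertions-disjoint (fullLinearTerms-unique m)))

fullLinearTerms-complete : (m : ℕ) {u : Term (suc m)} → FullLinear u → u ∈ fullLinearTerms m
fullLinearTerms-complete m {u} lin with insertion-complete u (lin zero)
fullLinearTerms-complete zero    lin | inj₁ refl = here refl
fullLinearTerms-complete (suc m) lin | inj₁ refl = contradiction (lin (suc zero)) λ ()
fullLinearTerms-complete zero    lin | inj₂ (t , _) = ⊥-elim (Term0-empty t)
fullLinearTerms-complete (suc m) lin | inj₂ (t , t↝u) = ∈-concatMap⁺ insertions (Any.map
  (λ { refl → ∈-insertions⁺ t↝u })
  (fullLinearTerms-complete m (Insertion-reflects-FullLinear t↝u lin)))

length-fullLinearTerms : (m : ℕ) → length (fullLinearTerms m) * m ! ≡ (m + m) !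
length-fullLinearTerms zero    = refl
length-fullLinearTerms (suc m) = begin
  length (concatMap insertions (fullLinearTerms m)) * suc m !
    ≡⟨ cong (_* suc m !) (length-concatMap-const insertions (All.map
         (λ {t} size≡ → trans (length-insertions t) (cong (2 *_) size≡))
         (fullLinearTerms-size m))) ⟩
  length (fullLinearTerms m) * (2 * suc (m + m)) * (suc m * m !)
    ≡⟨ regroup (length (fullLinearTerms m)) (m !) m ⟩
  suc (suc (m + m)) * (suc (m + m) * (length (fullLinearTerms m) * m !))
    ≡⟨ cong (λ x → suc (suc (m + m)) * (suc (m + m) * x)) (length-fullLinearTerms m) ⟩
  suc (suc (m + m)) !
    ≡⟨ cong (λ k → suc k !) (+-suc m m) ⟨
  (suc m + suc m) ! ∎
  where
  open ≡-Reasoning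
  regroup : ∀ L F m →
    L * (2 * suc (m + m)) * (suc m * F) ≡ suc (suc (m + m)) * (suc (m + m) * (L * F))
  regroup = solve-∀

-- Central binomial coefficients

nCk*k!*[n∸k]!≡n! : ∀ {n k} → k ≤ n → (n C k) * (k ! * (n ∸ k) !) ≡ n !
nCk*k!*[n∸k]!≡n! {n} {k} k≤n =
  trans (cong (_* (k ! * (n ∸ k) !)) (nCk≡n!/k![n-k]! k≤n))
        (m/n*n≡m {{k !* (n ∸ k) !≢0}} (k![n∸k]!∣n! k≤n))

nC[1+k]*[1+k]≡nCk*[n∸k] : ∀ {n k} → k < n → (n C suc k) * suc k ≡ (n C k) * (n ∸ k)
nC[1+k]*[1+k]≡nCk*[n∸k] {n} {k} k<n =
  *-cancelʳ-≡ _ _ (k ! * (n ∸ suc k) !) {{k !* (n ∸ suc k) !≢0}} (begin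
  (n C suc k) * suc k * (k ! * (n ∸ suc k) !)
    ≡⟨ regroupˡ (n C suc k) (suc k) (k !) ((n ∸ suc k) !) ⟩
  (n C suc k) * (suc k ! * (n ∸ suc k) !)
    ≡⟨ nCk*k!*[n∸k]!≡n! k<n ⟩
  n !
    ≡⟨ nCk*k!*[n∸k]!≡n! (<⇒≤ k<n) ⟨
  (n C k) * (k ! * (n ∸ k) !)
    ≡⟨ cong (λ x → (n C k) * (k ! * x)) ([n-k]*[n-k-1]!≡[n-k]! k<n) ⟨
  (n C k) * (k ! * ((n ∸ k) * (n ∸ suc k) !))
    ≡⟨ regroupʳ (n C k) (n ∸ k) (k !) ((n ∸ suc k) !) ⟩
  (n C k) * (n ∸ k) * (k ! * (n ∸ suc k) !) ∎)
  where
  open ≡-Reasoning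
  regroupˡ : ∀ X d F G → X * d * (F * G) ≡ X * (d * F * G)
  regroupˡ = solve-∀
  regroupʳ : ∀ X d F G → X * (F * (d * G)) ≡ X * d * (F * G)
  regroupʳ = solve-∀

[2m]C[1+m]*[1+m]≡[2m]Cm*m : ∀ m → ((m + m) C suc m) * suc m ≡ ((m + m) C m) * m
[2m]C[1+m]*[1+m]≡[2m]Cm*m zero    = refl
[2m]C[1+m]*[1+m]≡[2m]Cm*m m@(suc k) =
  trans (nC[1+k]*[1+k]≡nCk*[n∸k] (m<m+n m {m} z<s)) (cong (((m + m) C m) *_) (m+n∸m≡n m m))

1+m∣[2m]Cm : ∀ m → suc m ∣ (m + m) C m
1+m∣[2m]Cm m = ∣m+n∣m⇒∣n ∣[2m]Cm*[1+m] ∣[2m]Cm*m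
  where
  central : ℕ
  central = (m + m) C m
  ∣[2m]Cm*[1+m] : suc m ∣ central * m + central
  ∣[2m]Cm*[1+m] =
    subst (suc m ∣_) (trans (*-suc central m) (+-comm central (central * m))) (n∣m*n central)
  ∣[2m]Cm*m : suc m ∣ central * m
  ∣[2m]Cm*m = subst (suc m ∣_) ([2m]C[1+m]*[1+m]≡[2m]Cm*m m) (n∣m*n ((m + m) C suc m))

catalan*[1+m]≡[2m]Cm : ∀ m → catalan m * suc m ≡ (m + m) C m
catalan*[1+m]≡[2m]Cm m = m/n*n≡m (1+m∣[2m]Cm m)

[1+m]!*catalan*m!≡[2m]! : ∀ m → suc m ! * catalan m * m ! ≡ (m + m) !
[1+m]!*catalan*m!≡[2m]! m = begin
  suc m * m ! * catalan m * m !         ≡⟨ regroup (suc m) (m !) (catalan m) ⟩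
  catalan m * suc m * (m ! * m !)       ≡⟨ cong (_* (m ! * m !)) (catalan*[1+m]≡[2m]Cm m) ⟩
  ((m + m) C m) * (m ! * m !)           ≡⟨ cong (λ k → ((m + m) C m) * (m ! * k !)) (m+n∸m≡n m m) ⟨
  ((m + m) C m) * (m ! * (m + m ∸ m) !) ≡⟨ nCk*k!*[n∸k]!≡n! (m≤m+n m m) ⟩
  (m + m) !                             ∎
  where
  open ≡-Reasoning
  regroup : ∀ s F c → s * F * c * F ≡ c * s * (F * F)
  regroup = solve-∀

proposition3p1 : (m : ℕ) → AcSpectrumIs _∙_ (suc m) ((suc m) ! * catalan m)
proposition3p1 m =
  fullLinearTerms m ,
  fullLinearTerms-FullLinear m ,
  *-cancelʳ-≡ _ _ (m !) {{m !≢0}}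
    (trans (length-fullLinearTerms m) (sym ([1+m]!*catalan*m!≡[2m]! m))) ,
  AllPairs.map (λ s≢t same → s≢t (SameOp⇒≡ same)) (fullLinearTerms-unique m) ,
  λ t lin → Any.map (λ { refl _ → refl }) (fullLinearTerms-complete m {t} lin)
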